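{- Let $l\le k$ be nonnegative integers and let $\tau\in B_l$. Let $P=\tau(l+1)(l+2)\ldots k\in B_k$ and $Q=\bar{\tau}(l+1)(l+2)\ldots k\in B_k$. Then $P$ and $Q$ are Wilf equivalent, i.e. $|B_n(P)|=|B_n(Q)|$ for all $n\ge 1$. Moreover, $|SI_n(P)|=|SI_n(Q)|$ for all $n\ge1$.
   Context: $B_n$ is the set of signed permutations of $[n]=\{1,\dots,n\}$, written as words $\pi=\pi_1\cdots\pi_n$ in which each of $1,\dots,n$ appears exactly once, possibly barred (barred = negative, unbarred = positive). $|\pi_i|$ denotes the underlying unsigned value. For $\pi\in B_n$, $\bar{\pi}$ is obtained by changing the sign of every entry. A signed permutation $\pi\in B_n$ contains $\tau\in B_k$ if there are indices $i_1<\dots<i_k$ such that for all $a,b\in[k]$: $|\pi_{i_a}|<|\pi_{i_b}|$ iff $|\tau_a|<|\tau_b|$, and $\pi_{i_a}$ is positive iff $\tau_a$ is positive; otherwise $\pi$ avoids $\tau$. $M(\tau)$ denotes the set of elements of $M$ avoiding $\tau$. $SI_n\subseteq B_n$ is the set of signed involutions, i.e. signed permutations $\pi$ which, viewed as bijections of $\{\pm1,\dots,\pm n\}$ with $\pi(-i)=-\pi(i)$, satisfy $\pi\circ\pi=\mathrm{id}$. The word $\tau(l+1)(l+2)\ldots k$ denotes the concatenation of the word $\tau$ (on values $1,\dots,l$) with the unbarred letters $l+1,\dots,k$. -}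

module Defs where

open import Data.Bool using (Bool; true; false; _∧_; _∨_; not; if_then_else_)
open import Data.Nat using (ℕ; zero; suc; _+_; _<ᵇ_; _≡ᵇ_)
open import Data.List using (List; []; _∷_; map; concatMap; length; filter; upTo; _++_)
open import Data.Bool.ListAction using (all; any)
open import Data.Product using (_×_; _,_; proj₁; proj₂)
open import Data.Bool using (T)
open import Relation.Nullary.Decidable using (Dec)
open import Data.Bool.Properties using (T?)

-- A letter of a signed word: (sign , underlying value).
-- sign = true means positive (unbarred), false means negative (barred).
-- Values are 1-based natural numbers as in the paper.
Letter : Set
Letter = Bool × ℕ

Word : Set
Word = List Letter

range1 : ℕ → List ℕ
range1 n = map suc (upTo n)

count : ℕ → List Letter → ℕ
count v []             = 0
count v ((s , a) ∷ w)  = (if a ≡ᵇ v then 1 else 0) + count v w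

isSignedPerm : ℕ → Word → Bool
isSignedPerm n w = (length w ≡ᵇ n) ∧ all (λ v → count v w ≡ᵇ 1) (range1 n)

words : ℕ → ℕ → List Word
words n zero    = [] ∷ []
words n (suc m) =
  concatMap (λ w → concatMap (λ v → ((true , v) ∷ w) ∷ ((false , v) ∷ w) ∷ []) (range1 n))
            (words n m)

B : ℕ → List Word
B n = filter (λ w → T? (isSignedPerm n w)) (words n n)

subseqs : Word → List Word
subseqs []      = [] ∷ []
subseqs (x ∷ w) = map (x ∷_) (subseqs w) ++ subseqs w

eqBool : Bool → Bool → Bool
eqBool true  b = b
eqBool false b = not b

sameSigns : Word → Word → Bool
sameSigns []             []             = true
sameSigns ((s , _) ∷ σ)  ((t , _) ∷ τ)  = eqBool s t ∧ sameSigns σ τ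
sameSigns _              _              = false

zipW : Word → Word → List (ℕ × ℕ)
zipW []             _              = []
zipW (_ ∷ _)        []             = []
zipW ((_ , a) ∷ σ)  ((_ , b) ∷ τ)  = (a , b) ∷ zipW σ τ

orderIso : Word → Word → Bool
orderIso σ τ =
  let ps = zipW σ τ in
  all (λ p → all (λ q → eqBool (proj₁ p <ᵇ proj₁ q) (proj₂ p <ᵇ proj₂ q)) ps) ps

matches : Word → Word → Bool
matches σ τ = (length σ ≡ᵇ length τ) ∧ sameSigns σ τ ∧ orderIso σ τ

contains : Word → Word → Bool
contains π τ = any (λ σ → matches σ τ) (subseqs π)

avoids : Word → Word → Bool
avoids π τ = not (contains π τ)

-- signed permutation as a map on ±[n]: position i ↦ π_i (1-based);
-- π is a signed involution iff π(π(i)) = i for all i ∈ [n]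
-- (this is equivalent to π∘π = id on ±[n] since π(-i) = -π(i)).
lookupW : Word → ℕ → Letter
lookupW []       _       = (true , 0)
lookupW (x ∷ w)  1       = x
lookupW (x ∷ w)  (suc (suc i)) = lookupW w (suc i)
lookupW (x ∷ w)  zero    = (true , 0)

applyS : Word → Letter → Letter
applyS π (s , i) with lookupW π i
... | (t , j) = (eqBool s t , j)

isInvolution : Word → Bool
isInvolution π =
  all (λ i → let r = applyS π (applyS π (true , i)) in proj₁ r ∧ (proj₂ r ≡ᵇ i))
      (range1 (length π))

SI : ℕ → List Word
SI n = filter (λ w → T? (isInvolution w)) (B n)

Av : List Word → Word → List Word
Av M τ = filter (λ w → T? (avoids w τ)) M

bar : Word → Word
bar = map (λ p → (not (proj₁ p) , proj₂ p))

ascTail : ℕ → ℕ → List Letter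
ascTail l k = map (λ i → (true , i)) (Data.List.drop l (range1 k))

{-# OPTIONS --safe #-}
-- Put m = k − l and call a letter of a signed word m-rising if it is followed by m unbarred
-- letters whose values increase and exceed its own value. The map flipRising m changes the
-- sign of every m-rising letter. Flipping an m-rising letter neither creates nor destroys a
-- rise of length at most m above any threshold (a rise through it can be rerouted through the
-- rise that follows it), so flipRising m is a value-preserving involution of B n.
-- An occurrence of τ(l+1)…k in π is an occurrence of τ followed by an m-rise above all of its
-- values; every letter of the τ-part is then m-rising, hence flipped, while the rise survives.
-- So π contains τ(l+1)…k iff flipRising m π contains τ̄(l+1)…k, and the involution matches the
-- avoiders of the two patterns. In a signed involution, positions and values of a rise trade
-- places: a rise after position i above |π(i)| is a rise after position |π(i)| above i. Hence
-- i and |π(i)| are flipped together, and flipRising m maps SI n to itself.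
module Submission where

open import Defs

open import Data.Bool using (Bool; true; false; not; _∧_; _xor_; if_then_else_; T)
open import Data.Bool.ListAction using (all; and)
open import Data.Bool.Properties using (not-involutive; T-≡; T-∧; ∧-assoc)
open import Data.Empty using (⊥-elim)
open import Data.List using (List; []; _∷_; map; length; _++_; drop; concatMap; filter; upTo; applyUpTo)
open import Data.List.Extrema.Nat using (max; xs≤max; max<v⁺)
open import Data.List.Membership.Propositional using (_∈_; _∉_; find; lose)
open import Data.List.Membership.Propositional.Properties
  using (∈-map⁺; ∈-map⁻; ∈-++⁺ˡ; ∈-++⁺ʳ; ∈-++⁻; ∈-upTo⁺; ∈-upTo⁻; ∈-concatMap⁺; ∈-concatMap⁻
        ; ∈-filter⁺; ∈-filter⁻)
open import Data.List.Membership.Propositional.Properties.WithK using (unique∧set⇒bag)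
open import Data.List.Properties
  using (length-++; length-map; length-upTo; map-∘; map-cong; map-id; map-upTo; map-applyUpTo
        ; ∷-injectiveˡ; ∷-injectiveʳ)
open import Data.List.Relation.Binary.BagAndSetEquality using (∼bag⇒↭)
open import Data.List.Relation.Binary.Permutation.Propositional using (_↭_)
open import Data.List.Relation.Binary.Permutation.Propositional.Properties using (↭-length; filter-↭)
open import Data.List.Relation.Binary.Sublist.Propositional using (_⊆_; []; _∷_; _∷ʳ_)
open import Data.List.Relation.Binary.Sublist.Propositional.Properties using ([]⊆-universal; All-resp-⊆)
open import Data.List.Relation.Unary.All as All using (All; []; _∷_)
open import Data.List.Relation.Unary.All.Properties using (all⁺; all⁻; map⁺; map⁻; ++⁻ʳ)
open import Data.List.Relation.Unary.AllPairs using ([]; _∷_)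
open import Data.List.Relation.Unary.Any using (here; there)
open import Data.List.Relation.Unary.Any.Properties using (any⁺; any⁻)
open import Data.List.Relation.Unary.Unique.Propositional using (Unique)
import Data.List.Relation.Unary.Unique.Propositional.Properties as Unique
open import Data.Nat using (ℕ; zero; suc; _+_; _∸_; _≤_; _<_; _≥_; _<ᵇ_; _≡ᵇ_; _≤?_; _<?_; z≤n; s≤s; z<s)
open import Data.Nat.ListAction using (sum)
open import Data.Nat.Properties
  using ( ≤-refl; ≤-reflexive; ≤-trans; <-trans; ≤-<-trans; <⇒≤; <-irrefl; <⇒≱; n≤1+n; suc-injective
        ; +-identityʳ; +-suc; m+[n∸m]≡n; +-mono-≤; +-mono-≤-<; +-commutativeSemigroup
        ; <ᵇ-reflects-<; <⇒<ᵇ; ≡ᵇ⇒≡; ≡⇒≡ᵇ)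
open import Algebra.Properties.CommutativeSemigroup +-commutativeSemigroup using (interchange)
open import Data.Product using (∃; ∃₂; _×_; _,_; proj₁; proj₂; uncurry)
open import Data.Sum using (_⊎_; inj₁; inj₂; [_,_]′)
open import Data.Unit using (tt)
open import Function using (_∘_)
open import Function.Bundles using (_⇔_; mk⇔; Equivalence)
open import Relation.Binary.PropositionalEquality
  using (_≡_; refl; sym; trans; cong; cong₂; subst; subst₂; module ≡-Reasoning)
open import Relation.Nullary using (Dec; yes; no; does)
open import Relation.Nullary.Decidable using (T?; map′; _×-dec_; _⊎-dec_; does-⇔; dec-true)
open import Relation.Nullary.Reflects using (ofʸ; ofⁿ)

value : Letter → ℕ
value = proj₂

values : Word → List ℕ
values = map value

-- flipIf true is, definitionally, the letter map of bar.
flipIf : Bool → Letter → Letter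
flipIf b (s , a) = (b xor s , a)

eqBool-not : ∀ s t → eqBool (not s) (not t) ≡ eqBool s t
eqBool-not true t = not-involutive t
eqBool-not false t = refl

eqBool-xor : ∀ b s t → eqBool (b xor s) (b xor t) ≡ eqBool s t
eqBool-xor false s t = refl
eqBool-xor true s t = eqBool-not s t

flipIf-involutive : ∀ b x → flipIf b (flipIf b x) ≡ x
flipIf-involutive false x = refl
flipIf-involutive true (s , a) = cong (_, a) (not-involutive s)

-- Rises

data Rise : ℕ → Word → ℕ → Set where
  none : ∀ {v w} → Rise v w 0
  skip : ∀ {v w j} x → Rise v w j → Rise v (x ∷ w) j
  keep : ∀ {v a w j} → v < a → Rise a w j → Rise v ((true , a) ∷ w) (suc j)

rise? : ∀ j v w → Dec (Rise v w j)
rise? zero v w = yes none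
rise? (suc j) v [] = no λ ()
rise? (suc j) v ((false , a) ∷ w) = map′ (skip _) (λ { (skip _ r) → r }) (rise? (suc j) v w)
rise? (suc j) v ((true , a) ∷ w) =
  map′ [ uncurry keep , skip _ ]′ split ((v <? a ×-dec rise? j a w) ⊎-dec rise? (suc j) v w)
  where
    split : Rise v ((true , a) ∷ w) (suc j) → (v < a × Rise a w j) ⊎ Rise v w (suc j)
    split (skip _ r) = inj₂ r
    split (keep v<a r) = inj₁ (v<a , r)

Rise-lower : ∀ {u v w j} → u ≤ v → Rise v w j → Rise u w j
Rise-lower u≤v none = none
Rise-lower u≤v (skip x r) = skip x (Rise-lower u≤v r)
Rise-lower u≤v (keep v<a r) = keep (≤-<-trans u≤v v<a) r

Rise-shorten : ∀ {v w i j} → i ≤ j → Rise v w j → Rise v w i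
Rise-shorten z≤n r = none
Rise-shorten i≤j (skip x r) = skip x (Rise-shorten i≤j r)
Rise-shorten (s≤s i≤j) (keep v<a r) = keep v<a (Rise-shorten i≤j r)

Rise-++ : ∀ {v w j} u → Rise v w j → Rise v (u ++ w) j
Rise-++ [] r = r
Rise-++ (x ∷ u) r = skip x (Rise-++ u r)

-- Occurrences and matching

∈-subseqs⁻ : ∀ {σ} π → σ ∈ subseqs π → σ ⊆ π
∈-subseqs⁻ [] (here refl) = []
∈-subseqs⁻ (x ∷ π) σ∈ with ∈-++⁻ (map (x ∷_) (subseqs π)) σ∈
... | inj₂ σ∈rest = x ∷ʳ ∈-subseqs⁻ π σ∈rest
... | inj₁ σ∈init with σ′ , σ′∈ , refl ← ∈-map⁻ (x ∷_) σ∈init = refl ∷ ∈-subseqs⁻ π σ′∈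

∈-subseqs⁺ : ∀ {σ π} → σ ⊆ π → σ ∈ subseqs π
∈-subseqs⁺ [] = here refl
∈-subseqs⁺ (refl ∷ σ⊆π) = ∈-++⁺ˡ (∈-map⁺ (_ ∷_) (∈-subseqs⁺ σ⊆π))
∈-subseqs⁺ {π = y ∷ π} (y ∷ʳ σ⊆π) = ∈-++⁺ʳ (map (y ∷_) (subseqs π)) (∈-subseqs⁺ σ⊆π)

contains⇔ : ∀ {π τ} → T (contains π τ) ⇔ (∃ λ σ → σ ⊆ π × T (matches σ τ))
contains⇔ {π} {τ} = mk⇔ to from
  where
    to : T (contains π τ) → ∃ λ σ → σ ⊆ π × T (matches σ τ)
    to c with σ , σ∈ , m ← find (any⁻ (λ σ → matches σ τ) (subseqs π) c) = σ , ∈-subseqs⁻ π σ∈ , m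
    from : (∃ λ σ → σ ⊆ π × T (matches σ τ)) → T (contains π τ)
    from (σ , σ⊆π , m) = any⁺ (λ σ → matches σ τ) (lose (∈-subseqs⁺ σ⊆π) m)

++-⊆-split : ∀ {A : Set} (α : List A) {β π : List A} → α ++ β ⊆ π →
  ∃₂ λ π₁ π₂ → π ≡ π₁ ++ π₂ × α ⊆ π₁ × β ⊆ π₂
++-⊆-split [] {π = π} β⊆π = [] , π , refl , [] , β⊆π
++-⊆-split (x ∷ α) (y ∷ʳ p) with π₁ , π₂ , refl , α⊆ , β⊆ ← ++-⊆-split (x ∷ α) p =
  y ∷ π₁ , π₂ , refl , y ∷ʳ α⊆ , β⊆
++-⊆-split (x ∷ α) (refl ∷ p) with π₁ , π₂ , refl , α⊆ , β⊆ ← ++-⊆-split α p =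
  x ∷ π₁ , π₂ , refl , refl ∷ α⊆ , β⊆

++-length-split : ∀ {A : Set} l {m} (σ : List A) → length σ ≡ l + m →
  ∃₂ λ α β → σ ≡ α ++ β × length α ≡ l × length β ≡ m
++-length-split zero σ len = [] , σ , refl , refl , len
++-length-split (suc l) (x ∷ σ) len with α , β , refl , lα , lβ ← ++-length-split l σ (suc-injective len) =
  x ∷ α , β , refl , cong suc lα , lβ

Concordant : ℕ × ℕ → ℕ × ℕ → Set
Concordant p q = T (eqBool (proj₁ p <ᵇ proj₁ q) (proj₂ p <ᵇ proj₂ q))

AllConcordant : List (ℕ × ℕ) → List (ℕ × ℕ) → Set
AllConcordant ps qs = ∀ {p q} → p ∈ ps → q ∈ qs → Concordant p q

Matches : Word → Word → Set
Matches σ τ = length σ ≡ length τ × T (sameSigns σ τ) × AllConcordant (zipW σ τ) (zipW σ τ)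

matches⇔ : ∀ {σ τ} → T (matches σ τ) ⇔ Matches σ τ
matches⇔ {σ} {τ} = mk⇔ to from
  where
    ps : List (ℕ × ℕ)
    ps = zipW σ τ
    rows : ℕ × ℕ → Bool
    rows p = all (λ q → eqBool (proj₁ p <ᵇ proj₁ q) (proj₂ p <ᵇ proj₂ q)) ps
    to : T (matches σ τ) → Matches σ τ
    to t with len , rest ← Equivalence.to T-∧ t with signs , iso ← Equivalence.to T-∧ rest =
      ≡ᵇ⇒≡ _ _ len , signs ,
      λ p∈ q∈ → All.lookup (all⁺ _ ps (All.lookup (all⁺ rows ps iso) p∈)) q∈
    from : Matches σ τ → T (matches σ τ)
    from (len , signs , conc) = Equivalence.from T-∧ (≡⇒≡ᵇ _ _ len , Equivalence.from T-∧ (signs ,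
      all⁻ rows (All.tabulate λ p∈ → all⁻ _ (All.tabulate λ q∈ → conc p∈ q∈))))

AllConcordant-++ : ∀ {ps qs} → AllConcordant (ps ++ qs) (ps ++ qs) ⇔
  (AllConcordant ps ps × AllConcordant qs qs × AllConcordant ps qs × AllConcordant qs ps)
AllConcordant-++ {ps} {qs} = mk⇔ to from
  where
    to : AllConcordant (ps ++ qs) (ps ++ qs) →
         AllConcordant ps ps × AllConcordant qs qs × AllConcordant ps qs × AllConcordant qs ps
    to c = (λ p∈ q∈ → c (∈-++⁺ˡ p∈) (∈-++⁺ˡ q∈)) , (λ p∈ q∈ → c (∈-++⁺ʳ ps p∈) (∈-++⁺ʳ ps q∈))
         , (λ p∈ q∈ → c (∈-++⁺ˡ p∈) (∈-++⁺ʳ ps q∈)) , (λ p∈ q∈ → c (∈-++⁺ʳ ps p∈) (∈-++⁺ˡ q∈))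
    from : AllConcordant ps ps × AllConcordant qs qs × AllConcordant ps qs × AllConcordant qs ps →
           AllConcordant (ps ++ qs) (ps ++ qs)
    from (cpp , cqq , cpq , cqp) p∈ q∈ with ∈-++⁻ ps p∈ | ∈-++⁻ ps q∈
    ... | inj₁ p∈ps | inj₁ q∈ps = cpp p∈ps q∈ps
    ... | inj₂ p∈qs | inj₂ q∈qs = cqq p∈qs q∈qs
    ... | inj₁ p∈ps | inj₂ q∈qs = cpq p∈ps q∈qs
    ... | inj₂ p∈qs | inj₁ q∈ps = cqp p∈qs q∈ps

<ᵇ-true : ∀ {m n} → m < n → (m <ᵇ n) ≡ true
<ᵇ-true m<n = Equivalence.to T-≡ (<⇒<ᵇ m<n)

<ᵇ-false : ∀ {m n} → n ≤ m → (m <ᵇ n) ≡ false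
<ᵇ-false {m} {n} n≤m with m <ᵇ n | <ᵇ-reflects-< m n
... | false | _       = refl
... | true  | ofʸ m<n = ⊥-elim (<⇒≱ m<n n≤m)

Concordant-refl : ∀ p → Concordant p p
Concordant-refl (a , t) rewrite <ᵇ-false (≤-refl {a}) | <ᵇ-false (≤-refl {t}) = tt

Concordant-above : ∀ {a b t u} → t < u → Concordant (a , t) (b , u) ⇔ a < b
Concordant-above {a} {b} t<u rewrite <ᵇ-true t<u with a <ᵇ b | <ᵇ-reflects-< a b
... | true  | ofʸ a<b = mk⇔ (λ _ → a<b) (λ _ → tt)
... | false | ofⁿ a≮b = mk⇔ (λ ()) a≮b

Concordant-below : ∀ {a b t u} → t < u → a < b → Concordant (b , u) (a , t)
Concordant-below t<u a<b rewrite <ᵇ-false (<⇒≤ a<b) | <ᵇ-false (<⇒≤ t<u) = tt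

_≪_ : List ℕ → List ℕ → Set
as ≪ bs = ∀ {a b} → a ∈ as → b ∈ bs → a < b

≪-singleton : ∀ {a bs} → (∀ {b} → b ∈ bs → a < b) → (a ∷ []) ≪ bs
≪-singleton a<bs (here refl) b∈ = a<bs b∈

∈-zipW⁻ : ∀ {a t} σ τ → (a , t) ∈ zipW σ τ → a ∈ values σ × t ∈ values τ
∈-zipW⁻ (x ∷ σ) (y ∷ τ) (here refl) = here refl , here refl
∈-zipW⁻ (x ∷ σ) (y ∷ τ) (there p∈) with a∈ , t∈ ← ∈-zipW⁻ σ τ p∈ = there a∈ , there t∈

∈-zipW⁺ : ∀ {a} σ τ → length σ ≡ length τ → a ∈ values σ → ∃ λ t → (a , t) ∈ zipW σ τ
∈-zipW⁺ (x ∷ σ) ((_ , t) ∷ τ) len (here refl) = t , here refl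
∈-zipW⁺ (x ∷ σ) (y ∷ τ) len (there a∈) with t , p∈ ← ∈-zipW⁺ σ τ (suc-injective len) a∈ = t , there p∈

zipW-++ : ∀ α τ {β ρ} → length α ≡ length τ → zipW (α ++ β) (τ ++ ρ) ≡ zipW α τ ++ zipW β ρ
zipW-++ [] [] len = refl
zipW-++ (x ∷ α) (y ∷ τ) len = cong (_ ∷_) (zipW-++ α τ (suc-injective len))

sameSigns-++ : ∀ α τ {β ρ} → length α ≡ length τ →
  sameSigns (α ++ β) (τ ++ ρ) ≡ (sameSigns α τ ∧ sameSigns β ρ)
sameSigns-++ [] [] len = refl
sameSigns-++ ((s , _) ∷ α) ((t , _) ∷ τ) len =
  trans (cong (eqBool s t ∧_) (sameSigns-++ α τ (suc-injective len))) (sym (∧-assoc (eqBool s t) _ _))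

Matches-++ : ∀ {α β τ ρ} → length α ≡ length τ → length β ≡ length ρ → values τ ≪ values ρ →
  Matches (α ++ β) (τ ++ ρ) ⇔ (Matches α τ × Matches β ρ × values α ≪ values β)
Matches-++ {α} {β} {τ} {ρ} lα lβ τ≪ρ = mk⇔ to from
  where
    zips : zipW (α ++ β) (τ ++ ρ) ≡ zipW α τ ++ zipW β ρ
    zips = zipW-++ α τ lα
    signs : sameSigns (α ++ β) (τ ++ ρ) ≡ (sameSigns α τ ∧ sameSigns β ρ)
    signs = sameSigns-++ α τ lα

    to : Matches (α ++ β) (τ ++ ρ) → Matches α τ × Matches β ρ × values α ≪ values β
    to (_ , s , c) with sα , sβ ← Equivalence.to T-∧ (subst T signs s)
                   with cα , cβ , cαβ , _ ←
                          Equivalence.to AllConcordant-++ (subst (λ ps → AllConcordant ps ps) zips c) =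
      (lα , sα , cα) , (lβ , sβ , cβ) , cross
      where
        cross : values α ≪ values β
        cross a∈ b∈ with t , p∈ ← ∈-zipW⁺ α τ lα a∈ | u , q∈ ← ∈-zipW⁺ β ρ lβ b∈ =
          Equivalence.to (Concordant-above (τ≪ρ (proj₂ (∈-zipW⁻ α τ p∈)) (proj₂ (∈-zipW⁻ β ρ q∈)))) (cαβ p∈ q∈)

    from : Matches α τ × Matches β ρ × values α ≪ values β → Matches (α ++ β) (τ ++ ρ)
    from ((_ , sα , cα) , (_ , sβ , cβ) , α≪β) =
      length-≡ , subst T (sym signs) (Equivalence.from T-∧ (sα , sβ)) ,
      subst (λ ps → AllConcordant ps ps) (sym zips) (Equivalence.from AllConcordant-++ (cα , cβ , cαβ , cβα))
      where
        length-≡ : length (α ++ β) ≡ length (τ ++ ρ)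
        length-≡ = trans (length-++ α) (trans (cong₂ _+_ lα lβ) (sym (length-++ τ)))
        cαβ : AllConcordant (zipW α τ) (zipW β ρ)
        cαβ p∈ q∈ with a∈ , t∈ ← ∈-zipW⁻ α τ p∈ | b∈ , u∈ ← ∈-zipW⁻ β ρ q∈ =
          Equivalence.from (Concordant-above (τ≪ρ t∈ u∈)) (α≪β a∈ b∈)
        cβα : AllConcordant (zipW β ρ) (zipW α τ)
        cβα q∈ p∈ with a∈ , t∈ ← ∈-zipW⁻ α τ p∈ | b∈ , u∈ ← ∈-zipW⁻ β ρ q∈ =
          Concordant-below (τ≪ρ t∈ u∈) (α≪β a∈ b∈)

values-bar : ∀ w → values (bar w) ≡ values w
values-bar w = sym (map-∘ w)

bar-involutive : ∀ w → bar (bar w) ≡ w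
bar-involutive w = trans (sym (map-∘ w)) (trans (map-cong (flipIf-involutive true) w) (map-id w))

sameSigns-bar : ∀ σ τ → sameSigns (bar σ) (bar τ) ≡ sameSigns σ τ
sameSigns-bar [] [] = refl
sameSigns-bar [] (_ ∷ _) = refl
sameSigns-bar (_ ∷ _) [] = refl
sameSigns-bar ((s , _) ∷ σ) ((t , _) ∷ τ) = cong₂ _∧_ (eqBool-not s t) (sameSigns-bar σ τ)

zipW-bar : ∀ σ τ → zipW (bar σ) (bar τ) ≡ zipW σ τ
zipW-bar [] τ = refl
zipW-bar (_ ∷ _) [] = refl
zipW-bar (_ ∷ σ) (_ ∷ τ) = cong (_ ∷_) (zipW-bar σ τ)

Matches-bar : ∀ {σ τ} → Matches σ τ → Matches (bar σ) (bar τ)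
Matches-bar {σ} {τ} (len , signs , conc) =
  trans (length-map _ σ) (trans len (sym (length-map _ τ))) ,
  subst T (sym (sameSigns-bar σ τ)) signs ,
  subst (λ ps → AllConcordant ps ps) (sym (zipW-bar σ τ)) conc

-- Patterns ending in an ascending run

asc : ℕ → ℕ → Word
asc c zero = []
asc c (suc m) = (true , c) ∷ asc (suc c) m

length-asc : ∀ c m → length (asc c m) ≡ m
length-asc c zero = refl
length-asc c (suc m) = cong suc (length-asc (suc c) m)

asc-above : ∀ {c t} m → t ∈ values (asc c m) → c ≤ t
asc-above (suc m) (here refl) = ≤-refl
asc-above (suc m) (there t∈) = <⇒≤ (asc-above m t∈)

asc-applyUpTo : ∀ {f c} m → (∀ i → f i ≡ c + i) → applyUpTo (λ i → (true , f i)) m ≡ asc c m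
asc-applyUpTo zero _ = refl
asc-applyUpTo {f} {c} (suc m) f≡ =
  cong₂ _∷_ (cong (true ,_) (trans (f≡ 0) (+-identityʳ c)))
            (asc-applyUpTo {f ∘ suc} {suc c} m λ i → trans (f≡ (suc i)) (+-suc c i))

drop-applyUpTo : ∀ {A : Set} (f : ℕ → A) l m → drop l (applyUpTo f (l + m)) ≡ applyUpTo (f ∘ (l +_)) m
drop-applyUpTo f zero m = refl
drop-applyUpTo f (suc l) m = drop-applyUpTo (f ∘ suc) l m

ascTail≡asc : ∀ l m → ascTail l (l + m) ≡ asc (suc l) m
ascTail≡asc l m = begin
  map (true ,_) (drop l (map suc (upTo (l + m))))  ≡⟨ cong (map (true ,_) ∘ drop l) (map-upTo suc (l + m)) ⟩
  map (true ,_) (drop l (applyUpTo suc (l + m)))   ≡⟨ cong (map (true ,_)) (drop-applyUpTo suc l m) ⟩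
  map (true ,_) (applyUpTo (suc ∘ (l +_)) m)       ≡⟨ map-applyUpTo _ _ m ⟩
  applyUpTo (λ i → (true , suc (l + i))) m         ≡⟨ asc-applyUpTo m (λ _ → refl) ⟩
  asc (suc l) m                                    ∎
  where open ≡-Reasoning

data Ascent : ℕ → Word → Set where
  [] : ∀ {v} → Ascent v []
  _∷_ : ∀ {v b β} → v < b → Ascent b β → Ascent v ((true , b) ∷ β)

Ascent-above : ∀ {v b β} → Ascent v β → b ∈ values β → v < b
Ascent-above (v<b ∷ _) (here refl) = v<b
Ascent-above (v<b ∷ ascent) (there b∈) = <-trans v<b (Ascent-above ascent b∈)

Matches-asc⇒Ascent : ∀ {v c β} m → (∀ {b} → b ∈ values β → v < b) → Matches β (asc c m) → Ascent v β
Matches-asc⇒Ascent {β = []} m _ _ = []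
Matches-asc⇒Ascent {v} {c} {(s , b) ∷ β} (suc m) v<β match
  with (_ , tail , b≪β) ←
       Equivalence.to (Matches-++ {(s , b) ∷ []} {β} {(true , c) ∷ []} refl (suc-injective (proj₁ match))
                                  (≪-singleton (asc-above m))) match
  with true ← s =
  v<β (here refl) ∷ Matches-asc⇒Ascent m (b≪β (here refl)) tail

Ascent⇒Matches-asc : ∀ {v c β} m → Ascent v β → length β ≡ m → Matches β (asc c m)
Ascent⇒Matches-asc zero [] refl = refl , tt , λ ()
Ascent⇒Matches-asc {c = c} (suc m) (_∷_ {b = b} {β} _ ascent) len =
  Equivalence.from (Matches-++ {(true , b) ∷ []} {β} {(true , c) ∷ []} refl
                     (trans (suc-injective len) (sym (length-asc (suc c) m))) (≪-singleton (asc-above m)))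
    ((refl , tt , λ { (here refl) (here refl) → Concordant-refl (b , c) }) ,
     Ascent⇒Matches-asc m ascent (suc-injective len) ,
     ≪-singleton (Ascent-above ascent))

Rise⇒Ascent : ∀ {v w j} → Rise v w j → ∃ λ β → β ⊆ w × Ascent v β × length β ≡ j
Rise⇒Ascent {w = w} none = [] , []⊆-universal w , [] , refl
Rise⇒Ascent (skip x r) with β , β⊆ , ascent , len ← Rise⇒Ascent r = β , x ∷ʳ β⊆ , ascent , len
Rise⇒Ascent (keep v<a r) with β , β⊆ , ascent , len ← Rise⇒Ascent r =
  _ ∷ β , refl ∷ β⊆ , v<a ∷ ascent , cong suc len

Ascent⇒Rise : ∀ {v β w} → β ⊆ w → Ascent v β → Rise v w (length β)
Ascent⇒Rise [] [] = none
Ascent⇒Rise (y ∷ʳ β⊆) ascent = skip y (Ascent⇒Rise β⊆ ascent)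
Ascent⇒Rise (refl ∷ β⊆) (v<b ∷ ascent) = keep v<b (Ascent⇒Rise β⊆ ascent)

Bounded : ℕ → Word → Set
Bounded l τ = length τ ≡ l × All (_≤ l) (values τ)

Bounded-bar : ∀ {l τ} → Bounded l τ → Bounded l (bar τ)
Bounded-bar {τ = τ} (τ-length , τ≤l) =
  trans (length-map _ τ) τ-length , subst (All (_≤ _)) (sym (values-bar τ)) τ≤l

module AscendingTail (m : ℕ) {l : ℕ} {τ : Word} (τ-bounded : Bounded l τ) where

  private
    τ-length : length τ ≡ l
    τ-length = proj₁ τ-bounded

  τ≪asc : values τ ≪ values (asc (suc l) m)
  τ≪asc t∈ u∈ = ≤-<-trans (All.lookup (proj₂ τ-bounded) t∈) (asc-above m u∈)

  contains-++asc⇒ : ∀ {π} → All (0 <_) (values π) → T (contains π (τ ++ asc (suc l) m)) →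
    ∃₂ λ π₁ π₂ → π ≡ π₁ ++ π₂ × ∃ λ α → α ⊆ π₁ × Matches α τ × Rise (max 0 (values α)) π₂ m
  contains-++asc⇒ {π} π>0 c
    with σ , σ⊆π , σ-matches ← Equivalence.to contains⇔ c
    with match ← Equivalence.to (matches⇔ {σ}) σ-matches
    with α , β , refl , lα , lβ ← ++-length-split l σ
           (trans (proj₁ match) (trans (length-++ τ) (cong₂ _+_ τ-length (length-asc (suc l) m))))
    with π₁ , π₂ , refl , α⊆ , β⊆ ← ++-⊆-split α {β} {π} σ⊆π
    with α-matches , β-matches , α≪β ←
           Equivalence.to (Matches-++ {α} {β} (trans lα (sym τ-length))
                                          (trans lβ (sym (length-asc (suc l) m))) τ≪asc) match =
    π₁ , π₂ , refl , α , α⊆ , α-matches ,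
    subst (Rise M π₂) lβ (Ascent⇒Rise β⊆ (Matches-asc⇒Ascent m M<β β-matches))
    where
      M : ℕ
      M = max 0 (values α)
      β>0 : All (0 <_) (values β)
      β>0 = map⁺ (All-resp-⊆ β⊆ (++⁻ʳ π₁ (map⁻ π>0)))
      -- When τ is empty, M = 0: this is why π must have positive values.
      M<β : ∀ {b} → b ∈ values β → M < b
      M<β b∈ = max<v⁺ (All.lookup β>0 b∈) (All.tabulate λ a∈ → α≪β a∈ b∈)

  contains-++asc⇐ : ∀ {π α β M} → α ++ β ⊆ π → Matches α τ → All (_≤ M) (values α) →
    Ascent M β → length β ≡ m → T (contains π (τ ++ asc (suc l) m))
  contains-++asc⇐ {α = α} {β} σ⊆π α-matches α≤M ascent lβ =
    Equivalence.from contains⇔ (α ++ β , σ⊆π , Equivalence.from matches⇔ (Equivalence.from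
      (Matches-++ (proj₁ α-matches) (trans lβ (sym (length-asc (suc l) m))) τ≪asc)
      (α-matches , Ascent⇒Matches-asc m ascent lβ , α≪β)))
    where
      α≪β : values α ≪ values β
      α≪β a∈ b∈ = ≤-<-trans (All.lookup α≤M a∈) (Ascent-above ascent b∈)

-- The lists B n and SI n

∈-range1⁺ : ∀ {n v} → 0 < v → v ≤ n → v ∈ range1 n
∈-range1⁺ {v = suc v} _ v<n = ∈-map⁺ suc (∈-upTo⁺ v<n)

∈-range1⁻ : ∀ {n v} → v ∈ range1 n → 0 < v × v ≤ n
∈-range1⁻ v∈ with u , u∈ , refl ← ∈-map⁻ suc v∈ = z<s , ∈-upTo⁻ u∈

range1-unique : ∀ n → Unique (range1 n)
range1-unique n = Unique.map⁺ suc-injective (Unique.upTo⁺ n)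

concatMap-unique : ∀ {A B : Set} {f : A → List B} {xs} → Unique xs → (∀ x → Unique (f x)) →
  (∀ {x y z} → z ∈ f x → z ∈ f y → x ≡ y) → Unique (concatMap f xs)
concatMap-unique [] _ _ = []
concatMap-unique {f = f} {x ∷ xs} (x∉xs ∷ u) f-unique f-disjoint =
  Unique.++⁺ (f-unique x) (concatMap-unique u f-unique f-disjoint) λ (z∈fx , z∈rest) →
    let y , y∈ , z∈fy = find (∈-concatMap⁻ f {xs = xs} z∈rest) in All.lookup x∉xs y∈ (f-disjoint z∈fx z∈fy)

signings : ℕ → Word → List Word
signings v w = ((true , v) ∷ w) ∷ ((false , v) ∷ w) ∷ []

∈-signings⁻ : ∀ {z v w} → z ∈ signings v w → ∃ λ s → z ≡ (s , v) ∷ w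
∈-signings⁻ (here refl) = true , refl
∈-signings⁻ (there (here refl)) = false , refl

∈-signings⁺ : ∀ s {v w} → (s , v) ∷ w ∈ signings v w
∈-signings⁺ true = here refl
∈-signings⁺ false = there (here refl)

extensions : ℕ → Word → List Word
extensions n w = concatMap (λ v → signings v w) (range1 n)

∈-extensions⁻ : ∀ n w {z} → z ∈ extensions n w → ∃₂ λ s v → v ∈ range1 n × z ≡ (s , v) ∷ w
∈-extensions⁻ n w z∈
  with v , v∈ , z∈s ← find (∈-concatMap⁻ _ {xs = range1 n} z∈)
  with s , refl ← ∈-signings⁻ z∈s = s , v , v∈ , refl

extensions-unique : ∀ n w → Unique (extensions n w)
extensions-unique n w = concatMap-unique (range1-unique n) (λ _ → ((λ ()) ∷ []) ∷ [] ∷ []) same-value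
  where
    same-value : ∀ {v v′ z} → z ∈ signings v w → z ∈ signings v′ w → v ≡ v′
    same-value z∈ z∈′ with _ , refl ← ∈-signings⁻ z∈ with _ , refl ← ∈-signings⁻ z∈′ = refl

words-unique : ∀ n m → Unique (words n m)
words-unique n zero = [] ∷ []
words-unique n (suc m) = concatMap-unique (words-unique n m) (extensions-unique n) same-tail
  where
    same-tail : ∀ {w w′ z} → z ∈ extensions n w → z ∈ extensions n w′ → w ≡ w′
    same-tail {w} z∈ z∈′
      with _ , _ , _ , refl ← ∈-extensions⁻ n w z∈
      with _ , _ , _ , eq ← ∈-extensions⁻ n _ z∈′ = ∷-injectiveʳ eq

∈-words⁻ : ∀ n m {w} → w ∈ words n m → length w ≡ m × All (_∈ range1 n) (values w)
∈-words⁻ n zero (here refl) = refl , []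
∈-words⁻ n (suc m) w∈
  with u , u∈ , w∈ext ← find (∈-concatMap⁻ (extensions n) {xs = words n m} w∈)
  with _ , _ , v∈ , refl ← ∈-extensions⁻ n u w∈ext
  with len , vals ← ∈-words⁻ n m u∈ = cong suc len , v∈ ∷ vals

∈-words⁺ : ∀ n {w} → All (_∈ range1 n) (values w) → w ∈ words n (length w)
∈-words⁺ n {[]} [] = here refl
∈-words⁺ n {(s , v) ∷ w} (v∈ ∷ vals) =
  ∈-concatMap⁺ (extensions n) (lose (∈-words⁺ n vals) (∈-concatMap⁺ _ (lose v∈ (∈-signings⁺ s))))

count-values : ∀ v {w w′} → values w ≡ values w′ → count v w ≡ count v w′
count-values v {[]} {[]} _ = refl
count-values v {(_ , a) ∷ w} {_ ∷ w′} eq with refl ← ∷-injectiveˡ eq =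
  cong ((if a ≡ᵇ v then 1 else 0) +_) (count-values v (∷-injectiveʳ eq))

length-values : ∀ w → length (values w) ≡ length w
length-values = length-map value

isSignedPerm-values : ∀ n {w w′} → values w ≡ values w′ → isSignedPerm n w ≡ isSignedPerm n w′
isSignedPerm-values n {w} {w′} eq = cong₂ _∧_
  (cong (_≡ᵇ n) (trans (sym (length-values w)) (trans (cong length eq) (length-values w′))))
  (cong and (map-cong (λ v → cong (_≡ᵇ 1) (count-values v eq)) (range1 n)))

∈-B⁻ : ∀ n {π} → π ∈ B n → length π ≡ n × All (_∈ range1 n) (values π)
∈-B⁻ n π∈ = ∈-words⁻ n n (proj₁ (∈-filter⁻ (λ w → T? (isSignedPerm n w)) π∈))

B-positive : ∀ n {π} → π ∈ B n → All (0 <_) (values π)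
B-positive n π∈ = All.map (proj₁ ∘ ∈-range1⁻ {n}) (proj₂ (∈-B⁻ n π∈))

B-closed : ∀ n {π π′} → π ∈ B n → values π′ ≡ values π → π′ ∈ B n
B-closed n {π} {π′} π∈ eq
  with π∈words , signed ← ∈-filter⁻ (λ w → T? (isSignedPerm n w)) π∈
  with len , vals ← ∈-words⁻ n n π∈words =
  ∈-filter⁺ (λ w → T? (isSignedPerm n w))
    (subst (λ k → π′ ∈ words n k) len′ (∈-words⁺ n (subst (All _) (sym eq) vals)))
    (subst T (isSignedPerm-values n (sym eq)) signed)
  where
    len′ : length π′ ≡ n
    len′ = trans (sym (length-values π′)) (trans (cong length eq) (trans (length-values π) len))

B-unique : ∀ n → Unique (B n)
B-unique n = Unique.filter⁺ (λ w → T? (isSignedPerm n w)) (words-unique n n)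

SI-unique : ∀ n → Unique (SI n)
SI-unique n = Unique.filter⁺ (λ w → T? (isInvolution w)) (B-unique n)

occurrences : List ℕ → Word → ℕ
occurrences vs w = sum (map (λ v → count v w) vs)

hits : ℕ → List ℕ → ℕ
hits a vs = sum (map (λ v → if a ≡ᵇ v then 1 else 0) vs)

occurrences-[] : ∀ vs → occurrences vs [] ≡ 0
occurrences-[] [] = refl
occurrences-[] (v ∷ vs) = occurrences-[] vs

occurrences-∷ : ∀ vs s a w → occurrences vs ((s , a) ∷ w) ≡ hits a vs + occurrences vs w
occurrences-∷ [] s a w = refl
occurrences-∷ (v ∷ vs) s a w =
  trans (cong ((if a ≡ᵇ v then 1 else 0) + count v w +_) (occurrences-∷ vs s a w))
    (interchange (if a ≡ᵇ v then 1 else 0) (count v w) (hits a vs) (occurrences vs w))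

occurrences-ones : ∀ {w} vs → All (λ v → count v w ≡ 1) vs → occurrences vs w ≡ length vs
occurrences-ones [] [] = refl
occurrences-ones {w} (v ∷ vs) (once ∷ ones) = cong₂ _+_ once (occurrences-ones {w} vs ones)

hits-∉ : ∀ {a} vs → a ∉ vs → hits a vs ≡ 0
hits-∉ [] _ = refl
hits-∉ {a} (v ∷ vs) a∉ with a ≡ᵇ v in a≡ᵇv
... | true  = ⊥-elim (a∉ (here (≡ᵇ⇒≡ a v (Equivalence.from T-≡ a≡ᵇv))))
... | false = hits-∉ vs (a∉ ∘ there)

hits-unique : ∀ {a vs} → Unique vs → hits a vs ≤ 1
hits-unique [] = z≤n
hits-unique {a} {v ∷ vs} (v∉ ∷ u) with a ≡ᵇ v in a≡ᵇv
... | true  = s≤s (≤-reflexive (hits-∉ vs λ a∈ → All.lookup v∉ a∈ (sym (≡ᵇ⇒≡ a v (Equivalence.from T-≡ a≡ᵇv)))))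
... | false = hits-unique {a} u

occurrences≤length : ∀ {vs} → Unique vs → ∀ w → occurrences vs w ≤ length w
occurrences≤length {vs} _ [] = ≤-reflexive (occurrences-[] vs)
occurrences≤length {vs} u ((s , a) ∷ w) rewrite occurrences-∷ vs s a w =
  +-mono-≤ (hits-unique {a} u) (occurrences≤length u w)

occurrences<length : ∀ {vs} → Unique vs → ∀ {x w} → x ∈ w → value x ∉ vs → occurrences vs w < length w
occurrences<length {vs} u {w = (s , a) ∷ w} (here refl) a∉ rewrite occurrences-∷ vs s a w | hits-∉ vs a∉ =
  s≤s (occurrences≤length u w)
occurrences<length {vs} u {w = (s , a) ∷ w} (there x∈) x∉ rewrite occurrences-∷ vs s a w =
  +-mono-≤-< (hits-unique {a} u) (occurrences<length u x∈ x∉)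

-- The l values 1, …, l each occur once among the l letters of τ, leaving no room for any other value.
signedPerm-bounded : ∀ l τ → T (isSignedPerm l τ) → Bounded l τ
signedPerm-bounded l τ signed with len , counts ← Equivalence.to T-∧ signed =
  ≡ᵇ⇒≡ _ _ len , map⁺ (All.tabulate bounded)
  where
    ones : All (λ v → count v τ ≡ 1) (range1 l)
    ones = All.map (≡ᵇ⇒≡ _ _) (all⁺ _ (range1 l) counts)
    total : occurrences (range1 l) τ ≡ l
    total = trans (occurrences-ones {τ} (range1 l) ones) (trans (length-map suc (upTo l)) (length-upTo l))
    bounded : ∀ {x} → x ∈ τ → value x ≤ l
    bounded {x} x∈ with value x ≤? l
    ... | yes x≤l = x≤l
    ... | no x≰l = ⊥-elim (<-irrefl refl (subst₂ _<_ total (≡ᵇ⇒≡ _ _ len)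
                     (occurrences<length (range1-unique l) x∈ (x≰l ∘ proj₂ ∘ ∈-range1⁻))))

length-filter-involution : ∀ {A : Set} (φ : A → A) (f g : A → Bool) {xs : List A} → Unique xs →
  (∀ x → φ (φ x) ≡ x) → (∀ {x} → x ∈ xs → φ x ∈ xs) → (∀ {x} → x ∈ xs → f x ≡ g (φ x)) →
  length (filter (T? ∘ f) xs) ≡ length (filter (T? ∘ g) xs)
length-filter-involution φ f g {xs} xs-unique involutive closed agree =
  trans (length-filter-map xs agree) (↭-length (filter-↭ (T? ∘ g) map-φ↭))
  where
    length-filter-map : ∀ ys → (∀ {x} → x ∈ ys → f x ≡ g (φ x)) →
      length (filter (T? ∘ f) ys) ≡ length (filter (T? ∘ g) (map φ ys))
    length-filter-map [] _ = refl
    length-filter-map (y ∷ ys) agree rewrite agree (here refl) with g (φ y)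
    ... | true  = cong suc (length-filter-map ys (agree ∘ there))
    ... | false = length-filter-map ys (agree ∘ there)

    injective : ∀ {x y} → φ x ≡ φ y → x ≡ y
    injective {x} {y} eq = trans (sym (involutive x)) (trans (cong φ eq) (involutive y))

    map-φ↭ : map φ xs ↭ xs
    map-φ↭ = ∼bag⇒↭ (unique∧set⇒bag (Unique.map⁺ injective xs-unique) xs-unique (mk⇔ to from))
      where
        to : ∀ {x} → x ∈ map φ xs → x ∈ xs
        to x∈ with y , y∈ , refl ← ∈-map⁻ φ x∈ = closed y∈
        from : ∀ {x} → x ∈ xs → x ∈ map φ xs
        from {x} x∈ = subst (_∈ map φ xs) (involutive x) (∈-map⁺ φ (closed x∈))

-- Signed involutions

InvolutiveAt : Word → ℕ → Set
InvolutiveAt π i = let j = value (lookupW π i) in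
  T (eqBool (proj₁ (lookupW π i)) (proj₁ (lookupW π j))) × value (lookupW π j) ≡ i

isInvolution⇔ : ∀ π → T (isInvolution π) ⇔ All (InvolutiveAt π) (range1 (length π))
isInvolution⇔ π = mk⇔
  (λ inv → All.map (λ t → let same , back = Equivalence.to T-∧ t in same , ≡ᵇ⇒≡ _ _ back) (all⁺ _ _ inv))
  (λ h → all⁻ _ (All.map (λ (same , back) → Equivalence.from T-∧ (same , ≡⇒≡ᵇ _ _ back)) h))

involutive-positive : ∀ {π p w} → InvolutiveAt π p → lookupW π p ≡ (true , w) → lookupW π w ≡ (true , p)
involutive-positive {π} {p} inv look with lookupW π p | look
... | _ | refl = cong₂ _,_ (Equivalence.to T-≡ (proj₁ inv)) (proj₂ inv)

lookupW-∈ : ∀ π {p} → 0 < p × p ≤ length π → lookupW π p ∈ π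
lookupW-∈ (x ∷ π) {suc zero} _ = here refl
lookupW-∈ (x ∷ π) {suc (suc q)} (_ , s≤s p≤) = there (lookupW-∈ π (z<s , p≤))

InvolutiveAt-flipIf : ∀ {π ρ i} b → lookupW ρ i ≡ flipIf b (lookupW π i) →
  lookupW ρ (value (lookupW π i)) ≡ flipIf b (lookupW π (value (lookupW π i))) →
  InvolutiveAt π i → InvolutiveAt ρ i
InvolutiveAt-flipIf b e₁ e₂ (same , back) rewrite e₁ | e₂ = subst T (sym (eqBool-xor b _ _)) same , back

-- Positions are 1-based, as in lookupW: the first letter of the rise sits at position suc q.
FirstRiseStep : Word → ℕ → ℕ → ℕ → Set
FirstRiseStep π i v k = ∃₂ λ q w →
  i ≤ q × q < length π × lookupW π (suc q) ≡ (true , w) × v < w × Rise w (drop (suc q) π) k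

Rise-drop⁻ : ∀ {v k} i π → Rise v (drop i π) (suc k) → FirstRiseStep π i v k
Rise-drop⁻ zero [] ()
Rise-drop⁻ (suc i) [] ()
Rise-drop⁻ zero (x ∷ π) (skip _ r) with q , w , _ , q< , look , v<w , r′ ← Rise-drop⁻ zero π r =
  suc q , w , z≤n , s≤s q< , look , v<w , r′
Rise-drop⁻ zero ((true , a) ∷ π) (keep v<a r) = zero , a , z≤n , s≤s z≤n , refl , v<a , r
Rise-drop⁻ (suc i) (x ∷ π) r with q , w , i≤q , q< , look , v<w , r′ ← Rise-drop⁻ i π r =
  suc q , w , s≤s i≤q , s≤s q< , look , v<w , r′

Rise-drop⁺ : ∀ {v k} i π → FirstRiseStep π i v k → Rise v (drop i π) (suc k)
Rise-drop⁺ zero (x ∷ π) (zero , w , _ , _ , refl , v<w , r) = keep v<w r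
Rise-drop⁺ zero (x ∷ π) (suc q , w , _ , s≤s q< , look , v<w , r) =
  skip x (Rise-drop⁺ zero π (q , w , z≤n , q< , look , v<w , r))
Rise-drop⁺ (suc i) (x ∷ π) (suc q , w , s≤s i≤q , s≤s q< , look , v<w , r) =
  Rise-drop⁺ i π (q , w , i≤q , q< , look , v<w , r)

module _ {π : Word} (vals : All (_∈ range1 (length π)) (values π))
         (inv : All (InvolutiveAt π) (range1 (length π))) where

  Rise-transpose : ∀ k {i v} → Rise v (drop i π) k → Rise i (drop v π) k
  Rise-transpose zero _ = none
  Rise-transpose (suc k) {i} {v} r
    with q , w , i≤q , q< , look , v<w , r′ ← Rise-drop⁻ i π r
    with s≤s z≤n , w≤n ← ∈-range1⁻ (All.lookup vals (∈-map⁺ value (subst (_∈ π) look (lookupW-∈ π (z<s , q<)))))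
    with s≤s v≤ ← v<w =
    Rise-drop⁺ v π (_ , suc q , v≤ , w≤n , involutive-positive {π} (All.lookup inv (∈-range1⁺ z<s q<)) look ,
                    s≤s i≤q , Rise-transpose k r′)

-- Flipping the letters that start a long rise

module FlipRising (m : ℕ) where

  flipRising : Word → Word
  flipRising [] = []
  flipRising (x ∷ w) = flipIf (does (rise? m (value x) w)) x ∷ flipRising w

  private
    below-rising : ∀ {v a w j} → v < a → j ≤ m → Rise a w m → Rise v w j
    below-rising v<a j≤m r = Rise-lower (<⇒≤ v<a) (Rise-shorten j≤m r)

  Rise-flipRising⁺ : ∀ {v j} w → j ≤ m → Rise v w j → Rise v (flipRising w) j
  Rise-flipRising⁺ w j≤m none = none
  Rise-flipRising⁺ (x ∷ w) j≤m (skip x r) = skip _ (Rise-flipRising⁺ w j≤m r)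
  Rise-flipRising⁺ ((true , a) ∷ w) j≤m (keep v<a r) with rise? m a w
  ... | yes ra = skip _ (Rise-flipRising⁺ w j≤m (below-rising v<a j≤m ra))
  ... | no _   = keep v<a (Rise-flipRising⁺ w (≤-trans (n≤1+n _) j≤m) r)

  Rise-flipRising⁻ : ∀ {v j} w → j ≤ m → Rise v (flipRising w) j → Rise v w j
  Rise-flipRising⁻ [] j≤m r = r
  Rise-flipRising⁻ ((s , a) ∷ w) j≤m r with rise? m a w | s | r
  ... | yes ra | false | keep v<a _  = skip _ (below-rising v<a j≤m ra)
  ... | no _   | true  | keep v<a r′ = keep v<a (Rise-flipRising⁻ w (≤-trans (n≤1+n _) j≤m) r′)
  ... | _      | _     | skip _ r′   = skip _ (Rise-flipRising⁻ w j≤m r′)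
  ... | _      | _     | none        = none

  Rise-flipRising : ∀ {v j} w → j ≤ m → Rise v w j ⇔ Rise v (flipRising w) j
  Rise-flipRising w j≤m = mk⇔ (Rise-flipRising⁺ w j≤m) (Rise-flipRising⁻ w j≤m)

  flipRising-involutive : ∀ w → flipRising (flipRising w) ≡ w
  flipRising-involutive [] = refl
  flipRising-involutive (x ∷ w) = cong₂ _∷_ head (flipRising-involutive w)
    where
      b : Bool
      b = does (rise? m (value x) w)
      head : flipIf (does (rise? m (value x) (flipRising w))) (flipIf b x) ≡ x
      head = trans (cong (λ c → flipIf c (flipIf b x)) same) (flipIf-involutive b x)
        where
          same : does (rise? m (value x) (flipRising w)) ≡ b
          same = sym (does-⇔ (Rise-flipRising w ≤-refl)
                             (rise? m (value x) w) (rise? m (value x) (flipRising w)))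

  values-flipRising : ∀ w → values (flipRising w) ≡ values w
  values-flipRising [] = refl
  values-flipRising (x ∷ w) = cong (value x ∷_) (values-flipRising w)

  bar-++-⊆-flipRising : ∀ {M α γ π₁ π₂} → α ⊆ π₁ → All (_≤ M) (values α) → Rise M π₂ m →
    γ ⊆ flipRising π₂ → bar α ++ γ ⊆ flipRising (π₁ ++ π₂)
  bar-++-⊆-flipRising [] _ _ γ⊆ = γ⊆
  bar-++-⊆-flipRising (y ∷ʳ α⊆) α≤M r γ⊆ = _ ∷ʳ bar-++-⊆-flipRising α⊆ α≤M r γ⊆
  bar-++-⊆-flipRising {π₁ = x ∷ π₁} {π₂} (refl ∷ α⊆) (x≤M ∷ α≤M) r γ⊆ =
    cong (λ b → flipIf b x) (sym (dec-true (rise? m (value x) (π₁ ++ π₂)) (Rise-++ π₁ (Rise-lower x≤M r))))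
    ∷ bar-++-⊆-flipRising α⊆ α≤M r γ⊆

  contains-flipRising : ∀ {l τ π} → Bounded l τ → All (0 <_) (values π) →
    T (contains π (τ ++ asc (suc l) m)) → T (contains (flipRising π) (bar τ ++ asc (suc l) m))
  contains-flipRising τ-bounded π>0 c
    with π₁ , π₂ , refl , α , α⊆ , α-matches , r ← AscendingTail.contains-++asc⇒ m τ-bounded π>0 c
    with β , β⊆ , ascent , lβ ← Rise⇒Ascent (Equivalence.to (Rise-flipRising π₂ ≤-refl) r) =
    AscendingTail.contains-++asc⇐ m (Bounded-bar τ-bounded) (bar-++-⊆-flipRising α⊆ α≤M r β⊆)
      (Matches-bar α-matches) (subst (All (_≤ _)) (sym (values-bar α)) α≤M) ascent lβ
    where
      α≤M : All (_≤ max 0 (values α)) (values α)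
      α≤M = xs≤max 0 (values α)

  avoids-flipRising : ∀ {l τ π} → Bounded l τ → All (0 <_) (values π) →
    avoids π (τ ++ asc (suc l) m) ≡ avoids (flipRising π) (bar τ ++ asc (suc l) m)
  avoids-flipRising {l} {τ} {π} τ-bounded π>0 = cong not (does-⇔ (mk⇔ to from) (T? _) (T? _))
    where
      to : T (contains π (τ ++ asc (suc l) m)) → T (contains (flipRising π) (bar τ ++ asc (suc l) m))
      to = contains-flipRising τ-bounded π>0
      from : T (contains (flipRising π) (bar τ ++ asc (suc l) m)) → T (contains π (τ ++ asc (suc l) m))
      from c = subst₂ (λ π′ τ′ → T (contains π′ (τ′ ++ asc (suc l) m)))
                      (flipRising-involutive π) (bar-involutive τ)
        (contains-flipRising (Bounded-bar τ-bounded) (subst (All (0 <_)) (sym (values-flipRising π)) π>0) c)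

  lookupW-flipRising : ∀ π {p} → 0 < p × p ≤ length π →
    lookupW (flipRising π) p ≡ flipIf (does (rise? m (value (lookupW π p)) (drop p π))) (lookupW π p)
  lookupW-flipRising (x ∷ π) {suc zero} _ = refl
  lookupW-flipRising (x ∷ π) {suc (suc q)} (_ , s≤s p≤) = lookupW-flipRising π (z<s , p≤)

  length-flipRising : ∀ π → length (flipRising π) ≡ length π
  length-flipRising [] = refl
  length-flipRising (x ∷ π) = cong suc (length-flipRising π)

  involutive-flipRising : ∀ {π} → All (_∈ range1 (length π)) (values π) →
    All (InvolutiveAt π) (range1 (length π)) →
    All (InvolutiveAt (flipRising π)) (range1 (length (flipRising π)))
  involutive-flipRising {π} vals inv rewrite length-flipRising π = All.tabulate at
    where
      at : ∀ {i} → i ∈ range1 (length π) → InvolutiveAt (flipRising π) i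
      at {i} i∈ = InvolutiveAt-flipIf {π} {flipRising π} b (lookupW-flipRising π (∈-range1⁻ i∈))
        (trans (lookupW-flipRising π (∈-range1⁻ j∈)) (cong (λ c → flipIf c (lookupW π j)) same-flip))
        (All.lookup inv i∈)
        where
          j : ℕ
          j = value (lookupW π i)
          j∈ : j ∈ range1 (length π)
          j∈ = All.lookup vals (∈-map⁺ value (lookupW-∈ π (∈-range1⁻ i∈)))
          b : Bool
          b = does (rise? m j (drop i π))
          same-flip : does (rise? m (value (lookupW π j)) (drop j π)) ≡ b
          same-flip rewrite proj₂ (All.lookup inv i∈) =
            does-⇔ (mk⇔ (Rise-transpose vals inv m) (Rise-transpose vals inv m))
                   (rise? m i (drop j π)) (rise? m j (drop i π))

  SI-closed : ∀ n {π} → π ∈ SI n → flipRising π ∈ SI n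
  SI-closed n {π} π∈
    with π∈B , inv ← ∈-filter⁻ (λ w → T? (isInvolution w)) {xs = B n} π∈
    with len , vals ← ∈-B⁻ n π∈B =
    ∈-filter⁺ (λ w → T? (isInvolution w)) (B-closed n π∈B (values-flipRising π))
      (Equivalence.from (isInvolution⇔ (flipRising π))
        (involutive-flipRising (subst (λ k → All (_∈ range1 k) (values π)) (sym len) vals)
                               (Equivalence.to (isInvolution⇔ π) inv)))

theorem2p1 : (l k : ℕ) → l ≤ k → (τ : Word) → T (isSignedPerm l τ) →
    ((n : ℕ) → n ≥ 1 →
    length (Av (B n) (τ ++ ascTail l k)) ≡ length (Av (B n) (bar τ ++ ascTail l k)))
    × ((n : ℕ) → n ≥ 1 →
    length (Av (SI n) (τ ++ ascTail l k)) ≡ length (Av (SI n) (bar τ ++ ascTail l k)))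
theorem2p1 l k l≤k τ τ∈B = same-count-B , same-count-SI
  where
    m : ℕ
    m = k ∸ l
    open FlipRising m

    tail≡ : ascTail l k ≡ asc (suc l) m
    tail≡ = trans (cong (ascTail l) (sym (m+[n∸m]≡n l≤k))) (ascTail≡asc l m)

    agree : ∀ n {π} → π ∈ B n →
      avoids π (τ ++ ascTail l k) ≡ avoids (flipRising π) (bar τ ++ ascTail l k)
    agree n π∈ rewrite tail≡ = avoids-flipRising (signedPerm-bounded l τ τ∈B) (B-positive n π∈)

    same-count-B : (n : ℕ) → n ≥ 1 →
      length (Av (B n) (τ ++ ascTail l k)) ≡ length (Av (B n) (bar τ ++ ascTail l k))
    same-count-B n _ = length-filter-involution flipRising _ _ (B-unique n) flipRising-involutive
      (λ π∈ → B-closed n π∈ (values-flipRising _)) (agree n)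

    same-count-SI : (n : ℕ) → n ≥ 1 →
      length (Av (SI n) (τ ++ ascTail l k)) ≡ length (Av (SI n) (bar τ ++ ascTail l k))
    same-count-SI n _ = length-filter-involution flipRising _ _ (SI-unique n) flipRising-involutive
      (SI-closed n) (agree n ∘ proj₁ ∘ ∈-filter⁻ (λ w → T? (isInvolution w)) {xs = B n})
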